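{- Let $G$ be a simple graph and let $v_0\in V(G)$ with $N_G(v_0)=\{u_1,u_2\}$. (i) Suppose $u_1u_2\in E(G)$, let $G'=G-u_1u_2-v_0$ and $g\in\mathrm{SEDF}^0(G')$. Define $f:E(G)\to\{1,-1\}$ by $f(e)=g(e)$ for $e\in E(G')$, $f(v_0u_i)=1$ for $i=1,2$, and $f(u_1u_2)=-1$. Then $f\in\mathrm{SEDF}^0(G)$ and $f(G)=g(G')+1$. (ii) Suppose $u_1u_2\notin E(G)$, let $G'=G+u_1u_2-v_0$ and $g\in\mathrm{SEDF}^0(G')$. Define $f:E(G)\to\{1,-1\}$ by $f(e)=g(e)$ for $e\in E(G')\setminus\{u_1u_2\}$, $f(u_1v_0)=1$, and $f(u_2v_0)=g(u_1u_2)$. Then $f\in\mathrm{SEDF}^0(G)$ and $f(G)=g(G')+1$.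
   Context: All graphs are finite, simple and undirected. $N_G(v)$ is the set of neighbours of $v$ in $G$. For a graph $H$ and $f:E(H)\to\{1,-1\}$, let $f(v)=\sum_{e\in E_H(v)}f(e)$ for $v\in V(H)$, where $E_H(v)$ is the set of edges of $H$ incident to $v$, and $f(H)=\sum_{e\in E(H)}f(e)$. $\mathrm{SEDF}^0(H)$ is the set of functions $f:E(H)\to\{1,-1\}$ such that (a) $f(v)\ge 0$ for all $v\in V(H)$, and (b) $f(u)+f(v)\ge 2$ for every edge $e=uv\in E(H)$ with $f(e)=1$. -}

module Defs where

open import Data.Nat as ℕ using (ℕ; zero; suc)
open import Data.Fin using (Fin; zero; suc; toℕ; punchIn; _≟_)
open import Data.Bool using (Bool; true; false; _∧_; _∨_; not; T; if_then_else_)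
open import Data.Bool.Properties using (∧-comm; ∨-comm; ∧-zeroʳ)
open import Data.Sign using (Sign)
open import Data.Integer as ℤ using (ℤ; _◃_; +_)
open import Relation.Nullary using (¬_; does)
open import Relation.Binary.PropositionalEquality using (_≡_; refl; cong; cong₂; trans; sym)

record Graph (n : ℕ) : Set where
  field
    adj    : Fin n → Fin n → Bool
    adj-sym : ∀ u v → adj u v ≡ adj v u
    irrefl : ∀ v → adj v v ≡ false
open Graph public

Edge : ∀ {n} → Graph n → Fin n → Fin n → Set
Edge G u v = T (adj G u v)

isPair : ∀ {n} → Fin n → Fin n → Fin n → Fin n → Bool
isPair a b x y = (does (x ≟ a) ∧ does (y ≟ b)) ∨ (does (x ≟ b) ∧ does (y ≟ a))

isPair-sym : ∀ {n} (a b x y : Fin n) → isPair a b x y ≡ isPair a b y x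
isPair-sym a b x y =
  trans (cong₂ _∨_ (∧-comm (does (x ≟ a)) (does (y ≟ b)))
                   (∧-comm (does (x ≟ b)) (does (y ≟ a))))
        (∨-comm (does (y ≟ b) ∧ does (x ≟ a)) (does (y ≟ a) ∧ does (x ≟ b)))

removeEdge : ∀ {n} → Graph n → Fin n → Fin n → Graph n
removeEdge G a b = record
  { adj    = λ x y → adj G x y ∧ not (isPair a b x y)
  ; adj-sym = λ x y → cong₂ _∧_ (adj-sym G x y) (cong not (isPair-sym a b x y))
  ; irrefl = λ x → cong (λ t → t ∧ not (isPair a b x x)) (irrefl G x)
  }

addEdge : ∀ {n} → Graph n → Fin n → Fin n → Graph n
addEdge G a b = record
  { adj    = λ x y → adj G x y ∨ (isPair a b x y ∧ not (does (x ≟ y)))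
  ; adj-sym = λ x y → cong₂ _∨_ (adj-sym G x y)
                       (cong₂ _∧_ (isPair-sym a b x y) (cong not (≟-sym x y)))
  ; irrefl = λ x → irr x
  }
  where
  ≟-sym : ∀ {n} (x y : Fin n) → does (x ≟ y) ≡ does (y ≟ x)
  ≟-sym x y with x ≟ y | y ≟ x
  ... | Relation.Nullary.yes _ | Relation.Nullary.yes _ = refl
  ... | Relation.Nullary.no _  | Relation.Nullary.no _  = refl
  ... | Relation.Nullary.yes p | Relation.Nullary.no q  = Data.Empty.⊥-elim (q (sym p))
    where import Data.Empty
  ... | Relation.Nullary.no q  | Relation.Nullary.yes p = Data.Empty.⊥-elim (q (sym p))
    where import Data.Empty
  irr : ∀ x → (adj G x x ∨ (isPair a b x x ∧ not (does (x ≟ x)))) ≡ false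
  irr x with x ≟ x
  ... | Relation.Nullary.yes _ rewrite irrefl G x | ∧-zeroʳ (isPair a b x x) = refl
  ... | Relation.Nullary.no q = Data.Empty.⊥-elim (q refl)
    where import Data.Empty

-- G - v0 : delete vertex v0; the remaining vertices are Fin m,
-- embedded into Fin (suc m) via punchIn v0.
deleteVertex : ∀ {m} → Graph (suc m) → Fin (suc m) → Graph m
deleteVertex G v0 = record
  { adj    = λ i j → adj G (punchIn v0 i) (punchIn v0 j)
  ; adj-sym = λ i j → adj-sym G (punchIn v0 i) (punchIn v0 j)
  ; irrefl = λ i → irrefl G (punchIn v0 i)
  }

-- A function f : E(G) → {1,-1}, given on (ordered) adjacent pairs,
-- required to take the same value on uv and vu (so it is a function of the edge).
record EdgeFun {n} (G : Graph n) : Set where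
  field
    lab     : (u v : Fin n) → Edge G u v → Sign
    lab-sym : ∀ u v (p : Edge G u v) (q : Edge G v u) → lab u v p ≡ lab v u q
open EdgeFun public

val : Sign → ℤ
val s = s ◃ 1

Σ : (n : ℕ) → (Fin n → ℤ) → ℤ
Σ zero    h = + 0
Σ (suc n) h = h zero ℤ.+ Σ n (λ i → h (suc i))

weight : (b : Bool) → (T b → Sign) → ℤ
weight true  h = val (h Data.Unit.tt)
  where import Data.Unit
weight false h = + 0

vsum : ∀ {n} {G : Graph n} → EdgeFun G → Fin n → ℤ
vsum {n} {G} f v = Σ n (λ u → weight (adj G v u) (lab f v u))

-- f(G) = Σ_{e ∈ E(G)} f(e)   (each edge uv counted once, with toℕ u < toℕ v)
total : ∀ {n} {G : Graph n} → EdgeFun G → ℤ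
total {n} {G} f =
  Σ n (λ u → Σ n (λ v →
    if does (toℕ u ℕ.<? toℕ v) then weight (adj G u v) (lab f u v) else + 0))

SEDF0 : ∀ {n} {G : Graph n} → EdgeFun G → Set
SEDF0 {n} {G} f =
  (∀ v → + 0 ℤ.≤ vsum f v) Data.Product.×
  (∀ u v (p : Edge G u v) → lab f u v p ≡ Sign.+ → + 2 ℤ.≤ vsum f u ℤ.+ vsum f v)
  where import Data.Product

NbhdIs : ∀ {n} → Graph n → Fin n → Fin n → Fin n → Set
NbhdIs G v0 u1 u2 =
  (¬ u1 ≡ u2) Data.Product.×
  (∀ w → (Edge G v0 w → (w ≡ u1 Data.Sum.⊎ w ≡ u2)) Data.Product.×
         ((w ≡ u1 Data.Sum.⊎ w ≡ u2) → Edge G v0 w))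
  where import Data.Product
        import Data.Sum

-- Counting every edge from both of its ends gives Σ_v f(v) = 2 f(G), and likewise for g on G'.
-- Away from the pair u1u2, f and g agree on the edges of G - v0, so f(w) = g(w) at every vertex
-- w ∉ {v0, u1, u2}, while at u1 and u2 the vertex sums differ only by the weights of v0u_i and u1u2.
-- A direct computation gives f(v0) + (f(u1) - g(u1)) + (f(u2) - g(u2)) = 2 in both cases, hence
-- 2 f(G) = 2 g(G') + 2. No vertex sum decreases from g to f, every positive edge of f inside G - v0
-- is a positive edge of g, and the two edges at v0 are checked by hand, so f inherits SEDF⁰ from g.
module Submission where

open import Defs
open import Data.Nat as ℕ using (ℕ; zero; suc)
open import Data.Fin using (Fin; zero; suc; punchIn; punchOut; toℕ; _≟_)
open import Data.Fin.Properties using (punchInᵢ≢i; punchIn-injective; punchIn-punchOut; toℕ-injective)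
open import Data.Integer using (ℤ; +_; _+_; _-_; -_; _*_; _≤_; +≤+; nonNegative)
import Data.Integer.Properties as ℤP
import Data.Nat.Properties as ℕP
open import Data.Integer.Tactic.RingSolver using (solve-∀)
open import Data.Bool using (true; false; T; if_then_else_; _∧_; T?; not; _∨_)
open import Data.Bool.Properties using (T-∨; T-≡; T-not-≡; ∧-identityʳ; ∧-zeroʳ; ∨-identityʳ; ∨-zeroʳ)
open import Data.Unit using (tt)
open import Data.Empty using (⊥-elim)
open import Data.Sign using (Sign)
open import Data.Sign.Properties using (s≢opposite[s])
open import Relation.Nullary using (¬_; Dec; does; contradiction; yes; no)
open import Data.Product as Prod using (_×_; _,_; proj₁; proj₂; ∃)
open import Data.Sum as Sum using (_⊎_; inj₁; inj₂; [_,_])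
open import Function using (_∘_; _∘′_)
open import Function.Bundles using (Equivalence)
open import Relation.Nullary.Decidable using (dec-true; dec-false)
open import Relation.Binary using (tri<; tri≈; tri>)
open import Relation.Binary.PropositionalEquality hiding ([_])
open import Algebra.Properties.CommutativeMonoid.Sum ℤP.+-0-commutativeMonoid
  using (sum; sum-remove; ∑-distrib-+; ∑-comm)

Σ≡sum : ∀ n (h : Fin n → ℤ) → Σ n h ≡ sum h
Σ≡sum zero    h = refl
Σ≡sum (suc n) h = cong (_+_ (h zero)) (Σ≡sum n (λ i → h (suc i)))

Σ-cong : ∀ n {h h′ : Fin n → ℤ} → (∀ i → h i ≡ h′ i) → Σ n h ≡ Σ n h′
Σ-cong zero    eq = refl
Σ-cong (suc n) eq = cong₂ _+_ (eq zero) (Σ-cong n (λ i → eq (suc i)))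

Σ-remove : ∀ n (h : Fin (suc n) → ℤ) k → Σ (suc n) h ≡ h k + Σ n (λ i → h (punchIn k i))
Σ-remove n h k = begin
  Σ (suc n) h                          ≡⟨ Σ≡sum (suc n) h ⟩
  sum h                                ≡⟨ sum-remove h ⟩
  h k + sum (λ i → h (punchIn k i))    ≡⟨ cong (_+_ (h k)) (Σ≡sum n _) ⟨
  h k + Σ n (λ i → h (punchIn k i))    ∎
  where open ≡-Reasoning

Σ-distrib-+ : ∀ n (h h′ : Fin n → ℤ) → Σ n (λ i → h i + h′ i) ≡ Σ n h + Σ n h′
Σ-distrib-+ n h h′ = begin
  Σ n (λ i → h i + h′ i)   ≡⟨ Σ≡sum n _ ⟩
  sum (λ i → h i + h′ i)   ≡⟨ ∑-distrib-+ h h′ ⟩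
  sum h + sum h′           ≡⟨ cong₂ _+_ (Σ≡sum n h) (Σ≡sum n h′) ⟨
  Σ n h + Σ n h′           ∎
  where open ≡-Reasoning

Σ-comm : ∀ n (h : Fin n → Fin n → ℤ) → Σ n (λ i → Σ n (h i)) ≡ Σ n (λ j → Σ n (λ i → h i j))
Σ-comm n h = begin
  Σ n (λ i → Σ n (h i))                ≡⟨ Σ-cong n (λ i → Σ≡sum n (h i)) ⟩
  Σ n (λ i → sum (h i))                ≡⟨ Σ≡sum n _ ⟩
  sum (λ i → sum (h i))                ≡⟨ ∑-comm h ⟩
  sum (λ j → sum (λ i → h i j))        ≡⟨ Σ≡sum n _ ⟨
  Σ n (λ j → sum (λ i → h i j))        ≡⟨ Σ-cong n (λ j → Σ≡sum n _) ⟨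
  Σ n (λ j → Σ n (λ i → h i j))        ∎
  where open ≡-Reasoning

Σ-zero : ∀ n → Σ n (λ _ → + 0) ≡ + 0
Σ-zero zero    = refl
Σ-zero (suc n) = trans (ℤP.+-identityˡ _) (Σ-zero n)

Σ-update : ∀ {n} {h h′ : Fin n → ℤ} k → (∀ i → i ≢ k → h i ≡ h′ i) →
           Σ n h ≡ Σ n h′ + (h k - h′ k)
Σ-update {suc n} {h} {h′} k eq = begin
  Σ (suc n) h                ≡⟨ Σ-remove n h k ⟩
  h k + rest h               ≡⟨ cong (_+_ (h k)) (Σ-cong n (λ i → eq (punchIn k i) (punchInᵢ≢i k i))) ⟩
  h k + rest h′              ≡⟨ regroup (h k) (h′ k) (rest h′) ⟩
  (h′ k + rest h′) + (h k - h′ k) ≡⟨ cong (_+ (h k - h′ k)) (Σ-remove n h′ k) ⟨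
  Σ (suc n) h′ + (h k - h′ k)    ∎
  where
  open ≡-Reasoning
  rest : (Fin (suc n) → ℤ) → ℤ
  rest h = Σ n (λ i → h (punchIn k i))
  regroup : ∀ x y r → x + r ≡ (y + r) + (x - y)
  regroup = solve-∀

Σ-single : ∀ {n} {h : Fin n → ℤ} k → (∀ i → i ≢ k → h i ≡ + 0) → Σ n h ≡ h k
Σ-single {n} {h} k eq = begin
  Σ n h                              ≡⟨ Σ-update {h′ = λ _ → + 0} k eq ⟩
  Σ n (λ _ → + 0) + (h k - + 0)      ≡⟨ cong (_+ (h k - + 0)) (Σ-zero n) ⟩
  + 0 + (h k - + 0)                  ≡⟨ drop-zeros (h k) ⟩
  h k                                ∎
  where
  open ≡-Reasoning
  drop-zeros : ∀ x → + 0 + (x - + 0) ≡ x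
  drop-zeros = solve-∀

Σ-pair : ∀ {n} {h : Fin n → ℤ} {a b} → a ≢ b → (∀ i → i ≢ a → i ≢ b → h i ≡ + 0) →
         Σ n h ≡ h a + h b
Σ-pair {suc n} {h} {a} {b} a≢b eq = begin
  Σ (suc n) h                          ≡⟨ Σ-remove n h a ⟩
  h a + Σ n (λ i → h (punchIn a i))    ≡⟨ cong (_+_ (h a)) (Σ-single b′ off-b′) ⟩
  h a + h (punchIn a b′)               ≡⟨ cong (λ x → h a + h x) (punchIn-punchOut a≢b) ⟩
  h a + h b                            ∎
  where
  open ≡-Reasoning
  b′ = punchOut a≢b
  off-b′ : ∀ i → i ≢ b′ → h (punchIn a i) ≡ + 0
  off-b′ i i≢b′ = eq (punchIn a i) (punchInᵢ≢i a i)
    (λ e → i≢b′ (punchIn-injective a i b′ (trans e (sym (punchIn-punchOut a≢b)))))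

weight-cong : ∀ {b b′} {h : T b → Sign} {h′ : T b′ → Sign} →
              b ≡ b′ → (∀ p q → h p ≡ h′ q) → weight b h ≡ weight b′ h′
weight-cong {true}  refl eq = cong val (eq tt tt)
weight-cong {false} refl eq = refl

weight-true : ∀ {b} (h : T b → Sign) (p : T b) → weight b h ≡ val (h p)
weight-true {true} h tt = refl

weight-false : ∀ {b} (h : T b → Sign) → ¬ T b → weight b h ≡ + 0
weight-false {true}  h ¬p = contradiction tt ¬p
weight-false {false} h ¬p = refl

edgeWeight : ∀ {n} {G : Graph n} → EdgeFun G → Fin n → Fin n → ℤ
edgeWeight {G = G} f u v = weight (adj G u v) (lab f u v)

module _ {n} {G : Graph n} (f : EdgeFun G) where

  edgeWeight-sym : ∀ u v → edgeWeight f u v ≡ edgeWeight f v u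
  edgeWeight-sym u v = weight-cong (adj-sym G u v) (lab-sym f u v)

  edgeWeight-edge : ∀ {u v} (p : Edge G u v) → edgeWeight f u v ≡ val (lab f u v p)
  edgeWeight-edge {u} {v} = weight-true (lab f u v)

  edgeWeight-nonedge : ∀ {u v} → ¬ Edge G u v → edgeWeight f u v ≡ + 0
  edgeWeight-nonedge {u} {v} = weight-false (lab f u v)

  edgeWeight-diag : ∀ u → edgeWeight f u u ≡ + 0
  edgeWeight-diag u = edgeWeight-nonedge (subst T (irrefl G u))

  -- total f unfolds to Σ u Σ v forward u v.
  private
    forward : Fin n → Fin n → ℤ
    forward u v = if does (toℕ u ℕ.<? toℕ v) then edgeWeight f u v else + 0

    forward-< : ∀ {u v} → toℕ u ℕ.< toℕ v → forward u v ≡ edgeWeight f u v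
    forward-< {u} {v} lt = cong (if_then edgeWeight f u v else + 0) (dec-true (toℕ u ℕ.<? toℕ v) lt)

    forward-≮ : ∀ {u v} → ¬ toℕ u ℕ.< toℕ v → forward u v ≡ + 0
    forward-≮ {u} {v} ¬lt = cong (if_then edgeWeight f u v else + 0) (dec-false (toℕ u ℕ.<? toℕ v) ¬lt)

    edgeWeight-split : ∀ u v → edgeWeight f u v ≡ forward u v + forward v u
    edgeWeight-split u v with ℕP.<-cmp (toℕ u) (toℕ v)
    ... | tri< lt _ v≮u = begin
      edgeWeight f u v                     ≡⟨ ℤP.+-identityʳ _ ⟨
      edgeWeight f u v + + 0               ≡⟨ cong₂ _+_ (forward-< lt) (forward-≮ v≮u) ⟨
      forward u v + forward v u            ∎
      where open ≡-Reasoning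
    ... | tri> u≮v _ gt = begin
      edgeWeight f u v                     ≡⟨ edgeWeight-sym u v ⟩
      edgeWeight f v u                     ≡⟨ ℤP.+-identityˡ _ ⟨
      + 0 + edgeWeight f v u               ≡⟨ cong₂ _+_ (forward-≮ u≮v) (forward-< gt) ⟨
      forward u v + forward v u            ∎
      where open ≡-Reasoning
    ... | tri≈ u≮v eq v≮u rewrite toℕ-injective eq =
      trans (edgeWeight-diag v) (sym (cong₂ _+_ (forward-≮ u≮v) (forward-≮ v≮u)))

  Σ-vsum≡total+total : Σ n (vsum f) ≡ total f + total f
  Σ-vsum≡total+total = begin
    Σ n (vsum f)                                               ≡⟨ Σ-cong n (λ u → Σ-cong n (edgeWeight-split u)) ⟩
    Σ n (λ u → Σ n (λ v → forward u v + forward v u))          ≡⟨ Σ-cong n (λ u → Σ-distrib-+ n (forward u) (λ v → forward v u)) ⟩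
    Σ n (λ u → Σ n (forward u) + Σ n (λ v → forward v u))     ≡⟨ Σ-distrib-+ n _ _ ⟩
    total f + Σ n (λ u → Σ n (λ v → forward v u))             ≡⟨ cong (_+_ (total f)) (Σ-comm n (λ u v → forward v u)) ⟩
    total f + total f                                          ∎
    where open ≡-Reasoning

+-double-injective : ∀ {x y} → x + x ≡ y + y → x ≡ y
+-double-injective {x} {y} eq = ℤP.*-cancelˡ-≡ (+ 2) x y (begin
  + 2 * x   ≡⟨ double x ⟩
  x + x     ≡⟨ eq ⟩
  y + y     ≡⟨ double y ⟨
  + 2 * y   ∎)
  where
  open ≡-Reasoning
  double : ∀ z → + 2 * z ≡ z + z
  double = solve-∀

punchIn-or-pivot : ∀ {m} (v0 v : Fin (suc m)) → v ≡ v0 ⊎ ∃ λ i → punchIn v0 i ≡ v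
punchIn-or-pivot v0 v with v0 ≟ v
... | yes v0≡v = inj₁ (sym v0≡v)
... | no  v0≢v = inj₂ (punchOut v0≢v , punchIn-punchOut v0≢v)

neighbour-punchIn : ∀ {m} (G : Graph (suc m)) {v w} → Edge G v w → ∃ λ i → punchIn v i ≡ w
neighbour-punchIn G {v} {w} p with punchIn-or-pivot v w
... | inj₁ refl  = contradiction p (subst T (irrefl G v))
... | inj₂ found = found

module VertexDeletion {m} {G : Graph (suc m)} {G′ : Graph m}
                      (v0 : Fin (suc m)) (f : EdgeFun G) (g : EdgeFun G′) where

  excess : Fin m → ℤ
  excess i = vsum f (punchIn v0 i) - vsum g i

  excess-row : ∀ i k → (∀ j → j ≢ k → edgeWeight f (punchIn v0 i) (punchIn v0 j) ≡ edgeWeight g i j) →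
               excess i ≡ edgeWeight f (punchIn v0 i) v0
                            + (edgeWeight f (punchIn v0 i) (punchIn v0 k) - edgeWeight g i k)
  excess-row i k agree = begin
    vsum f u - vsum g i                                  ≡⟨ cong (_- vsum g i) (Σ-remove m (edgeWeight f u) v0) ⟩
    (edgeWeight f u v0 + Σ m row) - vsum g i             ≡⟨ cong (λ s → (edgeWeight f u v0 + s) - vsum g i) (Σ-update k agree) ⟩
    (edgeWeight f u v0 + (vsum g i + d)) - vsum g i      ≡⟨ cancel (edgeWeight f u v0) (vsum g i) d ⟩
    edgeWeight f u v0 + d                                ∎
    where
    open ≡-Reasoning
    u = punchIn v0 i
    row : Fin m → ℤ
    row j = edgeWeight f u (punchIn v0 j)
    d = edgeWeight f u (punchIn v0 k) - edgeWeight g i k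
    cancel : ∀ a s d → (a + (s + d)) - s ≡ a + d
    cancel = solve-∀

  total-step : ∀ c → vsum f v0 + Σ m excess ≡ c + c → total f ≡ total g + c
  total-step c eq = +-double-injective (begin
    total f + total f                                     ≡⟨ Σ-vsum≡total+total f ⟨
    Σ (suc m) (vsum f)                                    ≡⟨ Σ-remove m (vsum f) v0 ⟩
    vsum f v0 + Σ m (λ i → vsum f (punchIn v0 i))         ≡⟨ cong (_+_ (vsum f v0)) (Σ-cong m (λ i → split (vsum f (punchIn v0 i)) (vsum g i))) ⟩
    vsum f v0 + Σ m (λ i → vsum g i + excess i)           ≡⟨ cong (_+_ (vsum f v0)) (Σ-distrib-+ m (vsum g) excess) ⟩
    vsum f v0 + (Σ m (vsum g) + Σ m excess)               ≡⟨ cong (λ s → vsum f v0 + (s + Σ m excess)) (Σ-vsum≡total+total g) ⟩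
    vsum f v0 + ((total g + total g) + Σ m excess)        ≡⟨ regroup (vsum f v0) (total g) (Σ m excess) ⟩
    (total g + total g) + (vsum f v0 + Σ m excess)        ≡⟨ cong (_+_ (total g + total g)) eq ⟩
    (total g + total g) + (c + c)                         ≡⟨ interleave (total g) c ⟩
    (total g + c) + (total g + c)                         ∎)
    where
    open ≡-Reasoning
    split : ∀ x y → x ≡ y + (x - y)
    split = solve-∀
    regroup : ∀ a t e → a + ((t + t) + e) ≡ (t + t) + (a + e)
    regroup = solve-∀
    interleave : ∀ t c → (t + t) + (c + c) ≡ (t + c) + (t + c)
    interleave = solve-∀

  SEDF0-extend : SEDF0 g →
    (∀ i → + 0 ≤ excess i) →
    + 0 ≤ vsum f v0 →
    (∀ i (p : Edge G v0 (punchIn v0 i)) → lab f v0 (punchIn v0 i) p ≡ Sign.+ →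
       + 2 ≤ vsum f v0 + excess i) →
    (∀ i j (p : Edge G (punchIn v0 i) (punchIn v0 j)) → lab f (punchIn v0 i) (punchIn v0 j) p ≡ Sign.+ →
       ∃ λ (q : Edge G′ i j) → lab g i j q ≡ Sign.+) →
    SEDF0 f
  SEDF0-extend (g-nonneg , g-edge) excess-nonneg v0-nonneg v0-edge inner = nonneg , edge
    where
    g≤f : ∀ i → vsum g i ≤ vsum f (punchIn v0 i)
    g≤f i = ℤP.0≤i-j⇒j≤i (excess-nonneg i)

    v0-edge′ : ∀ i (p : Edge G v0 (punchIn v0 i)) → lab f v0 (punchIn v0 i) p ≡ Sign.+ →
               + 2 ≤ vsum f v0 + vsum f (punchIn v0 i)
    v0-edge′ i p +p = ℤP.≤-trans (v0-edge i p +p) (begin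
      vsum f v0 + excess i                   ≤⟨ ℤP.i≤i+j _ _ ⦃ nonNegative (g-nonneg i) ⦄ ⟩
      vsum f v0 + excess i + vsum g i        ≡⟨ regroup (vsum f v0) (vsum f (punchIn v0 i)) (vsum g i) ⟩
      vsum f v0 + vsum f (punchIn v0 i)      ∎)
      where
      open ℤP.≤-Reasoning
      regroup : ∀ a x y → a + (x - y) + y ≡ a + x
      regroup = solve-∀

    nonneg : ∀ v → + 0 ≤ vsum f v
    nonneg v with punchIn-or-pivot v0 v
    ... | inj₁ refl        = v0-nonneg
    ... | inj₂ (i , refl)  = ℤP.≤-trans (g-nonneg i) (g≤f i)

    edge : ∀ u v (p : Edge G u v) → lab f u v p ≡ Sign.+ → + 2 ≤ vsum f u + vsum f v
    edge u v p +p with punchIn-or-pivot v0 u | punchIn-or-pivot v0 v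
    ... | inj₁ refl       | inj₁ refl       = contradiction p (subst T (irrefl G v0))
    ... | inj₁ refl       | inj₂ (j , refl) = v0-edge′ j p +p
    ... | inj₂ (i , refl) | inj₁ refl       =
      subst (+ 2 ≤_) (ℤP.+-comm (vsum f v0) (vsum f (punchIn v0 i)))
            (v0-edge′ i p′ (trans (lab-sym f _ _ p′ p) +p))
      where p′ = subst T (adj-sym G (punchIn v0 i) v0) p
    ... | inj₂ (i , refl) | inj₂ (j , refl) =
      let q , +q = inner i j p +p
      in ℤP.≤-trans (g-edge i j q +q) (ℤP.+-mono-≤ (g≤f i) (g≤f j))

T-does-∧ : ∀ {P Q : Set} (p? : Dec P) (q? : Dec Q) → T (does p? ∧ does q?) → P × Q
T-does-∧ (yes p) (yes q) _ = p , q
T-does-∧ (yes _) (no _)  ()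
T-does-∧ (no _)  _       ()

isPair-sound : ∀ {n} {a b x y : Fin n} → T (isPair a b x y) → (x ≡ a × y ≡ b) ⊎ (x ≡ b × y ≡ a)
isPair-sound {a = a} {b} {x} {y} =
  Sum.map (T-does-∧ (x ≟ a) (y ≟ b)) (T-does-∧ (x ≟ b) (y ≟ a)) ∘′ Equivalence.to T-∨

isPair-self : ∀ {n} (a b : Fin n) → T (isPair a b a b)
isPair-self a b with a ≟ a | b ≟ b
... | yes _  | yes _  = tt
... | no a≢a | _      = contradiction refl a≢a
... | yes _  | no b≢b = contradiction refl b≢b

removeEdge-removes : ∀ {n} (G : Graph n) a b → ¬ Edge (removeEdge G a b) a b
removeEdge-removes G a b rewrite Equivalence.to T-≡ (isPair-self a b) | ∧-zeroʳ (adj G a b) = λ ()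

addEdge-adds : ∀ {n} (G : Graph n) {a b} → a ≢ b → Edge (addEdge G a b) a b
addEdge-adds G {a} {b} a≢b
  rewrite Equivalence.to T-≡ (isPair-self a b) | dec-false (a ≟ b) a≢b | ∨-zeroʳ (adj G a b) = tt

0≤1+val : ∀ σ → + 0 ≤ + 1 + val σ
0≤1+val Sign.+ = +≤+ ℕ.z≤n
0≤1+val Sign.- = +≤+ ℕ.z≤n

0≤1-val : ∀ σ → + 0 ≤ + 1 - val σ
0≤1-val Sign.+ = +≤+ ℕ.z≤n
0≤1-val Sign.- = +≤+ ℕ.z≤n

≡+⇒0≤ : ∀ {x n} → x ≡ + n → + 0 ≤ x
≡+⇒0≤ refl = +≤+ ℕ.z≤n

module DegreeTwoVertex {m} (G : Graph (suc m)) (v0 : Fin (suc m)) (a1 a2 : Fin m)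
                       (nbh : NbhdIs G v0 (punchIn v0 a1) (punchIn v0 a2)) where

  u1 u2 : Fin (suc m)
  u1 = punchIn v0 a1
  u2 = punchIn v0 a2

  a1≢a2 : a1 ≢ a2
  a1≢a2 = proj₁ nbh ∘ cong (punchIn v0)

  v0-u1 : Edge G v0 u1
  v0-u1 = proj₂ (proj₂ nbh u1) (inj₁ refl)

  v0-u2 : Edge G v0 u2
  v0-u2 = proj₂ (proj₂ nbh u2) (inj₂ refl)

  neighbour : ∀ i → Edge G v0 (punchIn v0 i) → i ≡ a1 ⊎ i ≡ a2
  neighbour i = Sum.map (punchIn-injective v0 i a1) (punchIn-injective v0 i a2) ∘ proj₁ (proj₂ nbh _)

  pair-index : ∀ {i j} → T (isPair u1 u2 (punchIn v0 i) (punchIn v0 j)) →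
               (i ≡ a1 × j ≡ a2) ⊎ (i ≡ a2 × j ≡ a1)
  pair-index = Sum.map (Prod.map (punchIn-injective v0 _ _) (punchIn-injective v0 _ _))
                       (Prod.map (punchIn-injective v0 _ _) (punchIn-injective v0 _ _))
             ∘ isPair-sound

  module Extension {G′ : Graph m} (f : EdgeFun G) (g : EdgeFun G′)
    (adj-agree : ∀ i j → ¬ T (isPair u1 u2 (punchIn v0 i) (punchIn v0 j)) →
                 adj G′ i j ≡ adj G (punchIn v0 i) (punchIn v0 j))
    (lab-agree : ∀ i j → ¬ T (isPair u1 u2 (punchIn v0 i) (punchIn v0 j)) →
                 ∀ p q → lab g i j p ≡ lab f (punchIn v0 i) (punchIn v0 j) q) where

    open VertexDeletion v0 f g public

    private
      weight-agree : ∀ i j → ¬ T (isPair u1 u2 (punchIn v0 i) (punchIn v0 j)) →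
                     edgeWeight f (punchIn v0 i) (punchIn v0 j) ≡ edgeWeight g i j
      weight-agree i j ¬t = weight-cong (sym (adj-agree i j ¬t)) (λ p q → sym (lab-agree i j ¬t q p))

      excess-partner : ∀ {i k} → (∀ {j} → T (isPair u1 u2 (punchIn v0 i) (punchIn v0 j)) → j ≡ k) →
                       excess i ≡ edgeWeight f (punchIn v0 i) v0
                                  + (edgeWeight f (punchIn v0 i) (punchIn v0 k) - edgeWeight g i k)
      excess-partner {i} {k} partner = excess-row i k (λ j j≢k → weight-agree i j (j≢k ∘ partner))

    vsum-v0 : vsum f v0 ≡ edgeWeight f v0 u1 + edgeWeight f v0 u2
    vsum-v0 = Σ-pair (proj₁ nbh) (λ w w≢u1 w≢u2 →
      edgeWeight-nonedge f ([ w≢u1 , w≢u2 ] ∘ proj₁ (proj₂ nbh w)))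

    excess-off : ∀ {i} → i ≢ a1 → i ≢ a2 → excess i ≡ + 0
    excess-off {i} i≢a1 i≢a2 = begin
      -- Row i agrees with g everywhere; taking i as its own partner leaves two diagonal weights.
      excess i                                        ≡⟨ excess-partner {k = i} (⊥-elim ∘ [ i≢a1 ∘ proj₁ , i≢a2 ∘ proj₁ ] ∘ pair-index) ⟩
      edgeWeight f u v0 + (edgeWeight f u u - edgeWeight g i i)
        ≡⟨ cong₂ _+_ (trans (edgeWeight-sym f u v0) (edgeWeight-nonedge f non-neighbour))
                     (cong₂ _-_ (edgeWeight-diag f u) (edgeWeight-diag g i)) ⟩
      + 0                                             ∎
      where
      open ≡-Reasoning
      u = punchIn v0 i
      non-neighbour : ¬ Edge G v0 u
      non-neighbour = [ i≢a1 , i≢a2 ] ∘ neighbour i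

    excess-a1 : excess a1 ≡ edgeWeight f v0 u1 + (edgeWeight f u1 u2 - edgeWeight g a1 a2)
    excess-a1 = trans (excess-partner ([ proj₂ , ⊥-elim ∘ a1≢a2 ∘ proj₁ ] ∘ pair-index))
                      (cong (_+ (edgeWeight f u1 u2 - edgeWeight g a1 a2)) (edgeWeight-sym f u1 v0))

    excess-a2 : excess a2 ≡ edgeWeight f v0 u2 + (edgeWeight f u2 u1 - edgeWeight g a2 a1)
    excess-a2 = trans (excess-partner ([ ⊥-elim ∘ a1≢a2 ∘ sym ∘ proj₁ , proj₂ ] ∘ pair-index))
                      (cong (_+ (edgeWeight f u2 u1 - edgeWeight g a2 a1)) (edgeWeight-sym f u2 v0))

    total-of : vsum f v0 + (excess a1 + excess a2) ≡ + 1 + + 1 → total f ≡ total g + + 1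
    total-of eq = total-step (+ 1)
      (trans (cong (_+_ (vsum f v0)) (Σ-pair a1≢a2 (λ _ → excess-off))) eq)

    SEDF0-of : SEDF0 g →
      + 0 ≤ vsum f v0 → + 0 ≤ excess a1 → + 0 ≤ excess a2 →
      (∀ p → lab f v0 u1 p ≡ Sign.+ → + 2 ≤ vsum f v0 + excess a1) →
      (∀ p → lab f v0 u2 p ≡ Sign.+ → + 2 ≤ vsum f v0 + excess a2) →
      (∀ p → lab f u1 u2 p ≢ Sign.+) →
      SEDF0 f
    SEDF0-of g-sedf v0-nonneg a1-nonneg a2-nonneg v0-u1-ok v0-u2-ok u1u2-not-plus =
      SEDF0-extend g-sedf excess-nonneg v0-nonneg v0-edge inner
      where
      excess-nonneg : ∀ i → + 0 ≤ excess i
      excess-nonneg i with i ≟ a1 | i ≟ a2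
      ... | yes refl | _        = a1-nonneg
      ... | no _     | yes refl = a2-nonneg
      ... | no i≢a1  | no i≢a2  = ℤP.≤-reflexive (sym (excess-off i≢a1 i≢a2))

      v0-edge : ∀ i (p : Edge G v0 (punchIn v0 i)) → lab f v0 (punchIn v0 i) p ≡ Sign.+ →
                + 2 ≤ vsum f v0 + excess i
      v0-edge i p with neighbour i p
      ... | inj₁ refl = v0-u1-ok p
      ... | inj₂ refl = v0-u2-ok p

      inner : ∀ i j (p : Edge G (punchIn v0 i) (punchIn v0 j)) → lab f (punchIn v0 i) (punchIn v0 j) p ≡ Sign.+ →
              ∃ λ (q : Edge G′ i j) → lab g i j q ≡ Sign.+
      inner i j p +p with T? (isPair u1 u2 (punchIn v0 i) (punchIn v0 j))
      ... | no ¬t = q , trans (lab-agree i j ¬t q p) +p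
        where q = subst T (sym (adj-agree i j ¬t)) p
      ... | yes t with pair-index t
      ... | inj₁ (refl , refl) = contradiction +p (u1u2-not-plus p)
      ... | inj₂ (refl , refl) = contradiction (trans (lab-sym f u1 u2 p′ p) +p) (u1u2-not-plus p′)
        where p′ = subst T (adj-sym G u2 u1) p

  reduction-with-edge : Edge G u1 u2 →
      (g : EdgeFun (deleteVertex (removeEdge G u1 u2) v0)) → SEDF0 g →
      (f : EdgeFun G) →
      (∀ i j (p : Edge (deleteVertex (removeEdge G u1 u2) v0) i j)
             (q : Edge G (punchIn v0 i) (punchIn v0 j)) →
             lab f (punchIn v0 i) (punchIn v0 j) q ≡ lab g i j p) →
      (∀ p → lab f v0 u1 p ≡ Sign.+) →
      (∀ p → lab f v0 u2 p ≡ Sign.+) →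
      (∀ p → lab f u1 u2 p ≡ Sign.-) →
      SEDF0 f × total f ≡ total g + + 1
  reduction-with-edge u1u2 g g-sedf f f≡g v0u1-plus v0u2-plus u1u2-minus =
    SEDF0-of g-sedf (≡+⇒0≤ vsum-v0≡2) (≡+⇒0≤ excess-a1≡0) (≡+⇒0≤ excess-a2≡0)
             (λ _ _ → ℤP.≤-reflexive (sym (cong₂ _+_ vsum-v0≡2 excess-a1≡0)))
             (λ _ _ → ℤP.≤-reflexive (sym (cong₂ _+_ vsum-v0≡2 excess-a2≡0)))
             (λ p → subst (_≢ Sign.+) (sym (u1u2-minus p)) (s≢opposite[s] Sign.-))
    , total-of (cong₂ _+_ vsum-v0≡2 (cong₂ _+_ excess-a1≡0 excess-a2≡0))
    where
    G′ = deleteVertex (removeEdge G u1 u2) v0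
    adj-agree : ∀ i j → ¬ T (isPair u1 u2 (punchIn v0 i) (punchIn v0 j)) →
                adj G′ i j ≡ adj G (punchIn v0 i) (punchIn v0 j)
    adj-agree i j ¬t = trans (cong (λ c → adj G (punchIn v0 i) (punchIn v0 j) ∧ not c) (dec-false (T? _) ¬t))
                             (∧-identityʳ _)
    open Extension f g adj-agree (λ i j _ p q → sym (f≡g i j p q))

    W-v0-u1 : edgeWeight f v0 u1 ≡ + 1
    W-v0-u1 = trans (edgeWeight-edge f v0-u1) (cong val (v0u1-plus v0-u1))
    W-v0-u2 : edgeWeight f v0 u2 ≡ + 1
    W-v0-u2 = trans (edgeWeight-edge f v0-u2) (cong val (v0u2-plus v0-u2))
    W-u1-u2 : edgeWeight f u1 u2 ≡ - + 1
    W-u1-u2 = trans (edgeWeight-edge f u1u2) (cong val (u1u2-minus u1u2))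
    W′-a1-a2 : edgeWeight g a1 a2 ≡ + 0
    W′-a1-a2 = edgeWeight-nonedge g (removeEdge-removes G u1 u2)

    vsum-v0≡2 : vsum f v0 ≡ + 2
    vsum-v0≡2 = trans vsum-v0 (cong₂ _+_ W-v0-u1 W-v0-u2)
    excess-a1≡0 : excess a1 ≡ + 0
    excess-a1≡0 = trans excess-a1 (cong₂ _+_ W-v0-u1 (cong₂ _-_ W-u1-u2 W′-a1-a2))
    excess-a2≡0 : excess a2 ≡ + 0
    excess-a2≡0 = trans excess-a2 (cong₂ _+_ W-v0-u2
      (cong₂ _-_ (trans (edgeWeight-sym f u2 u1) W-u1-u2) (trans (edgeWeight-sym g a2 a1) W′-a1-a2)))

  reduction-without-edge : ¬ Edge G u1 u2 →
      (g : EdgeFun (deleteVertex (addEdge G u1 u2) v0)) → SEDF0 g →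
      (f : EdgeFun G) →
      (∀ i j (p : Edge (deleteVertex (addEdge G u1 u2) v0) i j) →
             T (not (isPair u1 u2 (punchIn v0 i) (punchIn v0 j))) →
             (q : Edge G (punchIn v0 i) (punchIn v0 j)) →
             lab f (punchIn v0 i) (punchIn v0 j) q ≡ lab g i j p) →
      (∀ p → lab f u1 v0 p ≡ Sign.+) →
      (∀ (b1 b2 : Fin m) → punchIn v0 b1 ≡ u1 → punchIn v0 b2 ≡ u2 →
             ∀ p (q : Edge (deleteVertex (addEdge G u1 u2) v0) b1 b2) →
             lab f u2 v0 p ≡ lab g b1 b2 q) →
      SEDF0 f × total f ≡ total g + + 1
  reduction-without-edge u1u2∉ g g-sedf f f≡g u1v0-plus u2v0≡g =
    SEDF0-of g-sedf (subst (+ 0 ≤_) (sym vsum-v0≡1+s) (0≤1+val σ))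
             (subst (+ 0 ≤_) (sym excess-a1≡1-s) (0≤1-val σ)) (≡+⇒0≤ excess-a2≡0)
             (λ _ _ → ℤP.≤-reflexive (sym (trans (cong₂ _+_ vsum-v0≡1+s excess-a1≡1-s) (telescope s))))
             (λ p +p → ℤP.≤-reflexive (sym (cong₂ _+_ (vsum-v0≡2 p +p) excess-a2≡0)))
             (λ p → contradiction p u1u2∉)
    , total-of (trans (cong₂ _+_ vsum-v0≡1+s (cong₂ _+_ excess-a1≡1-s excess-a2≡0)) (telescope′ s))
    where
    G′ = deleteVertex (addEdge G u1 u2) v0
    zero-minus : ∀ x y → x + (+ 0 - y) ≡ x - y
    zero-minus = solve-∀
    telescope : ∀ s → (+ 1 + s) + (+ 1 - s) ≡ + 2
    telescope = solve-∀
    telescope′ : ∀ s → (+ 1 + s) + ((+ 1 - s) + + 0) ≡ + 1 + + 1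
    telescope′ = solve-∀
    adj-agree : ∀ i j → ¬ T (isPair u1 u2 (punchIn v0 i) (punchIn v0 j)) →
                adj G′ i j ≡ adj G (punchIn v0 i) (punchIn v0 j)
    adj-agree i j ¬t = trans (cong (λ c → adj G (punchIn v0 i) (punchIn v0 j) ∨ (c ∧ _)) (dec-false (T? _) ¬t))
                             (∨-identityʳ _)
    open Extension f g adj-agree (λ i j ¬t p q → sym (f≡g i j p (Equivalence.from T-not-≡ (dec-false (T? _) ¬t)) q))

    a1a2∈G′ : Edge G′ a1 a2
    a1a2∈G′ = addEdge-adds G (proj₁ nbh)
    σ = lab g a1 a2 a1a2∈G′
    s = val σ
    u2-v0 : Edge G u2 v0
    u2-v0 = subst T (adj-sym G v0 u2) v0-u2

    W-v0-u1 : edgeWeight f v0 u1 ≡ + 1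
    W-v0-u1 = trans (edgeWeight-sym f v0 u1) (trans (edgeWeight-edge f u1-v0) (cong val (u1v0-plus u1-v0)))
      where u1-v0 = subst T (adj-sym G v0 u1) v0-u1
    W-v0-u2 : edgeWeight f v0 u2 ≡ s
    W-v0-u2 = trans (edgeWeight-sym f v0 u2)
                    (trans (edgeWeight-edge f u2-v0) (cong val (u2v0≡g a1 a2 refl refl u2-v0 a1a2∈G′)))
    W-u1-u2 : edgeWeight f u1 u2 ≡ + 0
    W-u1-u2 = edgeWeight-nonedge f u1u2∉
    W′-a1-a2 : edgeWeight g a1 a2 ≡ s
    W′-a1-a2 = edgeWeight-edge g a1a2∈G′

    vsum-v0≡1+s : vsum f v0 ≡ + 1 + s
    vsum-v0≡1+s = trans vsum-v0 (cong₂ _+_ W-v0-u1 W-v0-u2)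
    vsum-v0≡2 : ∀ p → lab f v0 u2 p ≡ Sign.+ → vsum f v0 ≡ + 2
    vsum-v0≡2 p +p = trans vsum-v0≡1+s (cong (λ τ → + 1 + val τ) σ≡+)
      where σ≡+ = trans (sym (u2v0≡g a1 a2 refl refl u2-v0 a1a2∈G′)) (trans (lab-sym f u2 v0 u2-v0 p) +p)
    excess-a1≡1-s : excess a1 ≡ + 1 - s
    excess-a1≡1-s = trans excess-a1 (trans (cong₂ _+_ W-v0-u1 (cong₂ _-_ W-u1-u2 W′-a1-a2)) (zero-minus (+ 1) s))
    excess-a2≡0 : excess a2 ≡ + 0
    excess-a2≡0 = trans excess-a2 (trans (cong₂ _+_ W-v0-u2
      (cong₂ _-_ (trans (edgeWeight-sym f u2 u1) W-u1-u2) (trans (edgeWeight-sym g a2 a1) W′-a1-a2)))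
      (trans (zero-minus s s) (ℤP.+-inverseʳ s)))

lemma2p3 : ∀ {m : ℕ} (G : Graph (suc m)) (v0 u1 u2 : Fin (suc m)) →
    NbhdIs G v0 u1 u2 →
    (Edge G u1 u2 →
      (g : EdgeFun (deleteVertex (removeEdge G u1 u2) v0)) → SEDF0 g →
      (f : EdgeFun G) →
      (∀ i j (p : Edge (deleteVertex (removeEdge G u1 u2) v0) i j)
             (q : Edge G (punchIn v0 i) (punchIn v0 j)) →
             lab f (punchIn v0 i) (punchIn v0 j) q ≡ lab g i j p) →
      (∀ p → lab f v0 u1 p ≡ Sign.+) →
      (∀ p → lab f v0 u2 p ≡ Sign.+) →
      (∀ p → lab f u1 u2 p ≡ Sign.-) →
      SEDF0 f × total f ≡ total g + + 1)
    ×
    (¬ Edge G u1 u2 →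
      (g : EdgeFun (deleteVertex (addEdge G u1 u2) v0)) → SEDF0 g →
      (f : EdgeFun G) →
      (∀ i j (p : Edge (deleteVertex (addEdge G u1 u2) v0) i j) →
             T (not (isPair u1 u2 (punchIn v0 i) (punchIn v0 j))) →
             (q : Edge G (punchIn v0 i) (punchIn v0 j)) →
             lab f (punchIn v0 i) (punchIn v0 j) q ≡ lab g i j p) →
      (∀ p → lab f u1 v0 p ≡ Sign.+) →
      (∀ (a1 a2 : Fin m) → punchIn v0 a1 ≡ u1 → punchIn v0 a2 ≡ u2 →
             ∀ p (q : Edge (deleteVertex (addEdge G u1 u2) v0) a1 a2) →
             lab f u2 v0 p ≡ lab g a1 a2 q) →
      SEDF0 f × total f ≡ total g + + 1)
lemma2p3 G v0 u1 u2 nbh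
  with neighbour-punchIn G (proj₂ (proj₂ nbh u1) (inj₁ refl))
     | neighbour-punchIn G (proj₂ (proj₂ nbh u2) (inj₂ refl))
... | a1 , refl | a2 , refl = reduction-with-edge , reduction-without-edge
  where open DegreeTwoVertex G v0 a1 a2 nbh
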